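{- Let $X=\{X_1,X_2\}$ be a $\lambda_2$-equitable $2$-partition of $J(n,3)$ with quotient matrix $(p_{ij})$ satisfying $p_{11}\geq p_{22}$ and $p_{11}\geq 2n-7$. Let $\{a,b,c\}$ be a vertex with $\overline{abc}=1$, labelled so that $\overline{ab\ast}\geq\overline{ac\ast}\geq\overline{bc\ast}$, and suppose $\overline{ab\ast}-\overline{ac\ast}=(n-4)/2$ and $\overline{ac\ast}=\overline{bc\ast}$. For $d\in[n]\setminus\{a,b,c\}$ let $C_d=(\overline{abd},\overline{acd},\overline{bcd})$. Then one of the following holds: (i) every $C_d$ is $(1,1,1)$ or $(1,0,0)$; (ii) there are distinct $d,e\in[n]\setminus\{a,b,c\}$ with $C_d=(1,1,0)$, $C_e=(1,0,1)$, and $C_f\in\{(1,1,1),(1,0,0)\}$ for all other $f\in[n]\setminus\{a,b,c,d,e\}$.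
   Context: $J(n,3)$ ($n\geq 6$): vertices are the $3$-subsets of $[n]$, adjacent iff they share exactly two elements; it is $3(n-3)$-regular. An equitable $2$-partition with quotient matrix $(p_{ij})$ means each vertex of $X_i$ has exactly $p_{ij}$ neighbours in $X_j$; $\lambda_2$-equitable means $p_{11}-p_{21}=n-7$. $\overline{u}=1$ if $u\in X_1$, else $0$; $\overline{xyz}=\overline{\{x,y,z\}}$; $\overline{ij\ast}$ is the number of $3$-subsets containing $i,j$ lying in $X_1$. -}

module Defs where

open import Data.Nat using (ℕ; zero; suc; _+_; _*_; _≤_; _≥_; _≡ᵇ_)
open import Data.Bool using (Bool; true; false; _∧_; not)
open import Data.Fin using (Fin)
open import Data.Fin.Subset using (Subset; ⁅_⁆; _∪_; _∩_; ∣_∣; inside; outside)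
open import Data.Vec using (_∷_; []; lookup)
open import Data.List using (List; []; _∷_; _++_; map; length; filterᵇ)
open import Data.Product using (_×_; _,_; Σ)
open import Relation.Binary.PropositionalEquality using (_≡_)

allSubsets : (n : ℕ) → List (Subset n)
allSubsets zero = [] ∷ []
allSubsets (suc n) = map (outside ∷_) (allSubsets n) ++ map (inside ∷_) (allSubsets n)

J3vertices : (n : ℕ) → List (Subset n)
J3vertices n = filterᵇ (λ v → ∣ v ∣ ≡ᵇ 3) (allSubsets n)

adj : {n : ℕ} → Subset n → Subset n → Bool
adj u v = ∣ u ∩ v ∣ ≡ᵇ 2

triple : {n : ℕ} → Fin n → Fin n → Fin n → Subset n
triple x y z = ⁅ x ⁆ ∪ (⁅ y ⁆ ∪ ⁅ z ⁆)

-- A 2-partition {X₁, X₂} of the vertex set is given by the indicator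
-- X : Subset n → Bool of X₁ (u ∈ X₁ iff X u ≡ true, i.e. ū = 1);
-- X₂ is the complement.  Only values on 3-subsets matter.
Partition : ℕ → Set
Partition n = Subset n → Bool

deg₁ : {n : ℕ} → Partition n → Subset n → ℕ
deg₁ {n} X u = length (filterᵇ (λ v → adj u v ∧ X v) (J3vertices n))

deg₂ : {n : ℕ} → Partition n → Subset n → ℕ
deg₂ {n} X u = length (filterᵇ (λ v → adj u v ∧ not (X v)) (J3vertices n))

IsTwoPartition : {n : ℕ} → Partition n → Set
IsTwoPartition {n} X =
  Σ (Subset n) (λ u → ∣ u ∣ ≡ 3 × X u ≡ true) ×
  Σ (Subset n) (λ u → ∣ u ∣ ≡ 3 × X u ≡ false)

IsEquitable : {n : ℕ} → Partition n → ℕ → ℕ → ℕ → ℕ → Set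
IsEquitable {n} X p₁₁ p₁₂ p₂₁ p₂₂ =
  (u : Subset n) → ∣ u ∣ ≡ 3 →
    (X u ≡ true → deg₁ X u ≡ p₁₁ × deg₂ X u ≡ p₁₂) ×
    (X u ≡ false → deg₁ X u ≡ p₂₁ × deg₂ X u ≡ p₂₂)

-- λ₂-equitable: p₁₁ - p₂₁ = n - 7, written over ℕ as p₁₁ + 7 = n + p₂₁
IsLambda2 : ℕ → ℕ → ℕ → Set
IsLambda2 n p₁₁ p₂₁ = p₁₁ + 7 ≡ n + p₂₁

pairStar : {n : ℕ} → Partition n → Fin n → Fin n → ℕ
pairStar {n} X i j = length (filterᵇ (λ v → lookup v i ∧ (lookup v j ∧ X v)) (J3vertices n))

Cvec : {n : ℕ} → Partition n → Fin n → Fin n → Fin n → Fin n → Bool × Bool × Bool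
Cvec X a b c d = X (triple a b d) , X (triple a c d) , X (triple b c d)

data GoodC : Bool × Bool × Bool → Set where
  c111 : GoodC (true , true , true)
  c100 : GoodC (true , false , false)

module Submission where

-- Write P i j for the pair count pairStar X i j.  Counting the 3-sets through the
-- pairs of a vertex u = {x,y,z} gives deg₁ u + 3ū = P x y + P x z + P y z, so this sum
-- is p₁₁ + 3 on X₁ and p₂₁ on X₂; moreover P i j ≤ n − 2, with equality exactly when
-- every {i,j,d} lies in X₁.  At {a,b,c}, the relation P a b + 2 P a c = p₁₁ + 3, the gap
-- condition and 2n ≤ p₁₁ + 7 force P a b = n − 2 and 2 P a c = n, hence p₁₁ = 2n − 5,
-- p₂₁ = n + 2, and every {a,b,d} lies in X₁.  Because
-- P a c = P b c, the points d with C_d = (1,1,0) are exactly as many as those with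
-- C_d = (1,0,1).  A point of the first kind has P a d = n − 2 and P b d = 2; two of
-- them, d and d′, would give P d d′ = 2 and hence the sum 6 at {b,d,d′}, which is
-- neither 2n − 2 nor n + 2.  The same holds for the second kind with a and b swapped,
-- so there is either no such point or exactly one of each kind.

open import Defs
open import Data.Nat using (ℕ; zero; suc; _+_; _*_; _≤_; _<_; _≥_; _≡ᵇ_; z≤n; s≤s; _≤?_)
open import Data.Nat.Properties
  using (+-0-commutativeMonoid; +-commutativeSemigroup; +-mono-≤; +-monoˡ-≤; +-monoˡ-<;
         +-mono-<-≤; +-mono-≤-<; +-identityʳ; +-suc; +-comm; +-cancelˡ-≡; +-cancelʳ-≡;
         *-distribˡ-+; *-cancelˡ-≡; *-cancelˡ-<; <-irrefl; ≤-trans; ≤-reflexive; ≤-antisym;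
         <⇒≱; ≡ᵇ⇒≡; m≤n⇒m≤1+n; m<1+n⇒m≤n; n<1+n; module ≤-Reasoning)
open import Data.Nat.Tactic.RingSolver using (solve-∀; solve)
open import Data.Nat.ListAction using () renaming (sum to sumᴸ)
open import Data.Nat.ListAction.Properties using (sum-++)
open import Data.Bool as Bool using (Bool; true; false; _∧_; _∨_; not; T)
open import Data.Bool.Properties using (∧-zeroʳ; ∧-assoc; ∧-identityʳ; ∨-zeroʳ)
open import Data.Fin using (Fin; zero; suc)
open import Data.Fin.Properties using (any?)
open import Data.Fin.Subset using (Subset; ⁅_⁆; _∪_; _∩_; ∣_∣; inside; outside) renaming (⊥ to ∅)
open import Data.Fin.Subset.Properties
  using (x∈⁅x⁆; x∈⁅y⁆⇒x≡y; ∪-identityˡ; ∪-comm; ∪-assoc; ∩-zeroˡ; ∣⊥∣≡0; ∣⁅x⁆∣≡1)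
open import Data.Vec using (_∷_; []; lookup; toList)
open import Data.Vec.Properties using (lookup-replicate; lookup-zipWith; []=⇒lookup; lookup⇒[]=)
open import Data.List as L using (_++_; map; length; filterᵇ)
open import Data.List.Properties using (map-++; map-∘)
open import Data.Product using (_×_; _,_; Σ; proj₁; proj₂; ∃-syntax)
open import Data.Sum as Sum using (_⊎_; inj₁; inj₂)
open import Data.Empty using (⊥; ⊥-elim)
open import Function using (_∘_; case_of_)
open import Relation.Nullary using (Dec; yes; no; ¬_)
open import Relation.Nullary.Decidable using (_×-dec_; from-no)
open import Relation.Binary.PropositionalEquality
open import Algebra.Properties.CommutativeMonoid.Sum +-0-commutativeMonoid
  using (sum; sum-syntax; sum-cong-≗; ∑-distrib-+; sum-replicate-zero)
open import Algebra.Properties.CommutativeSemigroup +-commutativeSemigroup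
  using (interchange; xy∙z≈xz∙y)

⟦_⟧ : Bool → ℕ
⟦ true ⟧ = 1
⟦ false ⟧ = 0

true≢false : true ≢ false
true≢false ()

⟦∧⟧≤⟦⟧ : ∀ x y → ⟦ x ∧ y ⟧ ≤ ⟦ x ⟧
⟦∧⟧≤⟦⟧ false y = z≤n
⟦∧⟧≤⟦⟧ true false = z≤n
⟦∧⟧≤⟦⟧ true true = ≤-reflexive refl

⟦⟧≤1 : ∀ x → ⟦ x ⟧ ≤ 1
⟦⟧≤1 false = z≤n
⟦⟧≤1 true  = s≤s z≤n

∑-mono-≤ : ∀ {n} {f g : Fin n → ℕ} → (∀ i → f i ≤ g i) → sum f ≤ sum g
∑-mono-≤ {zero} f≤g = z≤n
∑-mono-≤ {suc n} f≤g = +-mono-≤ (f≤g zero) (∑-mono-≤ (f≤g ∘ suc))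

∑-mono-< : ∀ {n} {f g : Fin n → ℕ} → (∀ i → f i ≤ g i) → ∀ k → f k < g k → sum f < sum g
∑-mono-< f≤g zero    fk<gk = +-mono-<-≤ fk<gk (∑-mono-≤ (f≤g ∘ suc))
∑-mono-< f≤g (suc k) fk<gk = +-mono-≤-< (f≤g zero) (∑-mono-< (f≤g ∘ suc) k fk<gk)

lookup-∪ : ∀ {n} (p q : Subset n) i → lookup (p ∪ q) i ≡ lookup p i ∨ lookup q i
lookup-∪ p q i = lookup-zipWith _∨_ i p q

lookup-⁅x⁆-x : ∀ {n} (i : Fin n) → lookup ⁅ i ⁆ i ≡ true
lookup-⁅x⁆-x i = []=⇒lookup (x∈⁅x⁆ i)

lookup-⁅y⁆⇒≡ : ∀ {n} {i j : Fin n} → lookup ⁅ j ⁆ i ≡ true → i ≡ j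
lookup-⁅y⁆⇒≡ {i = i} {j} eq = x∈⁅y⁆⇒x≡y j (lookup⇒[]= i ⁅ j ⁆ eq)

lookup-⁅y⁆-≢ : ∀ {n} {i j : Fin n} → i ≢ j → lookup ⁅ j ⁆ i ≡ false
lookup-⁅y⁆-≢ {i = i} {j} i≢j with lookup ⁅ j ⁆ i in eq
... | true  = ⊥-elim (i≢j (lookup-⁅y⁆⇒≡ {i = i} {j} eq))
... | false = refl

∉-pair : ∀ {n} {i j k : Fin n} → i ≢ j → i ≢ k → lookup (⁅ j ⁆ ∪ ⁅ k ⁆) i ≡ false
∉-pair {i = i} {j} {k} i≢j i≢k =
  trans (lookup-∪ ⁅ j ⁆ ⁅ k ⁆ i) (cong₂ _∨_ (lookup-⁅y⁆-≢ i≢j) (lookup-⁅y⁆-≢ i≢k))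

∉-triple : ∀ {n} {a b c d : Fin n} → d ≢ a → d ≢ b → d ≢ c → lookup (triple a b c) d ≡ false
∉-triple {a = a} {b} {c} {d} d≢a d≢b d≢c =
  trans (lookup-∪ ⁅ a ⁆ (⁅ b ⁆ ∪ ⁅ c ⁆) d) (cong₂ _∨_ (lookup-⁅y⁆-≢ d≢a) (∉-pair d≢b d≢c))

∉-triple⁻ : ∀ {n} {a b c d : Fin n} → lookup (triple a b c) d ≡ false → d ≢ a × d ≢ b × d ≢ c
∉-triple⁻ {a = a} {b} {c} d∉ =
    (λ { refl → true≢false (trans (sym ∋a) d∉) })
  , (λ { refl → true≢false (trans (sym ∋b) d∉) })
  , (λ { refl → true≢false (trans (sym ∋c) d∉) })
  where
  ∋a : lookup (triple a b c) a ≡ true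
  ∋a rewrite lookup-∪ ⁅ a ⁆ (⁅ b ⁆ ∪ ⁅ c ⁆) a | lookup-⁅x⁆-x a = refl
  ∋b : lookup (triple a b c) b ≡ true
  ∋b rewrite lookup-∪ ⁅ a ⁆ (⁅ b ⁆ ∪ ⁅ c ⁆) b | lookup-∪ ⁅ b ⁆ ⁅ c ⁆ b | lookup-⁅x⁆-x b = ∨-zeroʳ _
  ∋c : lookup (triple a b c) c ≡ true
  ∋c rewrite lookup-∪ ⁅ a ⁆ (⁅ b ⁆ ∪ ⁅ c ⁆) c | lookup-∪ ⁅ b ⁆ ⁅ c ⁆ c | lookup-⁅x⁆-x c
           | ∨-zeroʳ (lookup ⁅ b ⁆ c) = ∨-zeroʳ _

triple-rotate : ∀ {n} (a b c : Fin n) → triple a b c ≡ triple b c a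
triple-rotate a b c = trans (∪-comm ⁅ a ⁆ (⁅ b ⁆ ∪ ⁅ c ⁆)) (∪-assoc ⁅ b ⁆ ⁅ c ⁆ ⁅ a ⁆)

triple-swap : ∀ {n} (a b c : Fin n) → triple a c b ≡ triple a b c
triple-swap a b c = cong (⁅ a ⁆ ∪_) (∪-comm ⁅ c ⁆ ⁅ b ⁆)

∣⁅i⁆∪p∣ : ∀ {n} (i : Fin n) (p : Subset n) → lookup p i ≡ false → ∣ ⁅ i ⁆ ∪ p ∣ ≡ suc ∣ p ∣
∣⁅i⁆∪p∣ zero    (outside ∷ p) _ = cong (suc ∘ ∣_∣) (∪-identityˡ p)
∣⁅i⁆∪p∣ (suc i) (outside ∷ p) i∉p = ∣⁅i⁆∪p∣ i p i∉p
∣⁅i⁆∪p∣ (suc i) (inside ∷ p)  i∉p = cong suc (∣⁅i⁆∪p∣ i p i∉p)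

∣⁅i⁆∩q∣ : ∀ {n} (i : Fin n) (q : Subset n) → ∣ ⁅ i ⁆ ∩ q ∣ ≡ ⟦ lookup q i ⟧
∣⁅i⁆∩q∣ {suc n} zero (inside ∷ q)  rewrite ∩-zeroˡ q = cong suc (∣⊥∣≡0 n)
∣⁅i⁆∩q∣ {suc n} zero (outside ∷ q) rewrite ∩-zeroˡ q = ∣⊥∣≡0 n
∣⁅i⁆∩q∣ (suc i) (_ ∷ q)       = ∣⁅i⁆∩q∣ i q

∣⁅i⁆∪p∩q∣ : ∀ {n} (i : Fin n) (p q : Subset n) → lookup p i ≡ false →
           ∣ (⁅ i ⁆ ∪ p) ∩ q ∣ ≡ ⟦ lookup q i ⟧ + ∣ p ∩ q ∣
∣⁅i⁆∪p∩q∣ zero    (outside ∷ p) (inside ∷ q)  _ rewrite ∪-identityˡ p = refl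
∣⁅i⁆∪p∩q∣ zero    (outside ∷ p) (outside ∷ q) _ rewrite ∪-identityˡ p = refl
∣⁅i⁆∪p∩q∣ (suc i) (s ∷ p)       (x ∷ q) i∉p with s ∧ x
... | true  = trans (cong suc (∣⁅i⁆∪p∩q∣ i p q i∉p)) (sym (+-suc _ _))
... | false = ∣⁅i⁆∪p∩q∣ i p q i∉p

∣pair∣ : ∀ {n} {i j : Fin n} → i ≢ j → ∣ ⁅ i ⁆ ∪ ⁅ j ⁆ ∣ ≡ 2
∣pair∣ {i = i} {j} i≢j = trans (∣⁅i⁆∪p∣ i ⁅ j ⁆ (lookup-⁅y⁆-≢ i≢j)) (cong suc (∣⁅x⁆∣≡1 j))

∣triple∣ : ∀ {n} {a b c : Fin n} → a ≢ b → a ≢ c → b ≢ c → ∣ triple a b c ∣ ≡ 3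
∣triple∣ {a = a} {b} {c} a≢b a≢c b≢c =
  trans (∣⁅i⁆∪p∣ a (⁅ b ⁆ ∪ ⁅ c ⁆) (∉-pair a≢b a≢c)) (cong suc (∣pair∣ b≢c))

∣triple∩∣ : ∀ {n} {a b c : Fin n} → a ≢ b → a ≢ c → b ≢ c → ∀ v →
           ∣ triple a b c ∩ v ∣ ≡ ⟦ lookup v a ⟧ + (⟦ lookup v b ⟧ + ⟦ lookup v c ⟧)
∣triple∩∣ {a = a} {b} {c} a≢b a≢c b≢c v =
  trans (∣⁅i⁆∪p∩q∣ a (⁅ b ⁆ ∪ ⁅ c ⁆) v (∉-pair a≢b a≢c))
        (cong (⟦ lookup v a ⟧ +_) (trans (∣⁅i⁆∪p∩q∣ b ⁅ c ⁆ v (lookup-⁅y⁆-≢ b≢c))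
                                        (cong (⟦ lookup v b ⟧ +_) (∣⁅i⁆∩q∣ c v))))

∑-⁅⁆ : ∀ {n} (k : Fin n) (p : Fin n → Bool) → ∑[ d < n ] ⟦ lookup ⁅ k ⁆ d ∧ p d ⟧ ≡ ⟦ p k ⟧
∑-⁅⁆ {suc n} zero p = trans (cong (⟦ p zero ⟧ +_) ∑∅≡0) (+-identityʳ _)
  where
  ∑∅≡0 : ∑[ d < n ] ⟦ lookup (∅ {n}) d ∧ p (suc d) ⟧ ≡ 0
  ∑∅≡0 = trans (sum-cong-≗ (λ d → cong (λ b → ⟦ b ∧ p (suc d) ⟧) (lookup-replicate d false)))
               (sum-replicate-zero n)
∑-⁅⁆ (suc k) p = ∑-⁅⁆ k (p ∘ suc)

count∉ : ∀ {n} → Subset n → (Fin n → Bool) → ℕ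
count∉ {n} S p = ∑[ d < n ] ⟦ not (lookup S d) ∧ p d ⟧

count∉-cong : ∀ {n} (S : Subset n) {p q : Fin n → Bool} → (∀ d → p d ≡ q d) → count∉ S p ≡ count∉ S q
count∉-cong S p≗q = sum-cong-≗ λ d → cong (λ b → ⟦ not (lookup S d) ∧ b ⟧) (p≗q d)

∑∉+∣S∣≡n : ∀ {n} (S : Subset n) → ∑[ d < n ] ⟦ not (lookup S d) ⟧ + ∣ S ∣ ≡ n
∑∉+∣S∣≡n []          = refl
∑∉+∣S∣≡n (inside ∷ S)  = trans (+-suc _ ∣ S ∣) (cong suc (∑∉+∣S∣≡n S))
∑∉+∣S∣≡n (outside ∷ S) = cong suc (∑∉+∣S∣≡n S)

count∉+∣S∣≤n : ∀ {n} (S : Subset n) p → count∉ S p + ∣ S ∣ ≤ n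
count∉+∣S∣≤n {n} S p = ≤-trans (+-monoˡ-≤ ∣ S ∣ (∑-mono-≤ λ d → ⟦∧⟧≤⟦⟧ (not (lookup S d)) (p d)))
                               (≤-reflexive (∑∉+∣S∣≡n S))

count∉-saturated : ∀ {n} (S : Subset n) p → count∉ S p + ∣ S ∣ ≡ n →
                   ∀ {d} → lookup S d ≡ false → p d ≡ true
count∉-saturated {n} S p full {d} d∉S with p d in pd
... | true  = refl
... | false = ⊥-elim (<-irrefl refl n<n)
  where
  open ≤-Reasoning
  p≤1 : ∀ e → ⟦ not (lookup S e) ∧ p e ⟧ ≤ ⟦ not (lookup S e) ⟧
  p≤1 e = ⟦∧⟧≤⟦⟧ (not (lookup S e)) (p e)
  at-d : ⟦ not (lookup S d) ∧ p d ⟧ < ⟦ not (lookup S d) ⟧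
  at-d rewrite d∉S | pd = s≤s z≤n
  n<n : n < n
  n<n = begin-strict
    n                                        ≡⟨ full ⟨
    count∉ S p + ∣ S ∣                       <⟨ +-monoˡ-< ∣ S ∣ (∑-mono-< p≤1 d at-d) ⟩
    ∑[ e < n ] ⟦ not (lookup S e) ⟧ + ∣ S ∣  ≡⟨ ∑∉+∣S∣≡n S ⟩
    n                                        ∎

count∉-split : ∀ {n} (S : Subset n) p {k} → lookup S k ≡ false →
               count∉ S p ≡ ⟦ p k ⟧ + count∉ (⁅ k ⁆ ∪ S) p
count∉-split {n} S p {k} k∉S = begin
  count∉ S p
    ≡⟨ sum-cong-≗ pointwise ⟩
  ∑[ d < n ] (⟦ lookup ⁅ k ⁆ d ∧ p d ⟧ + ⟦ not (lookup (⁅ k ⁆ ∪ S) d) ∧ p d ⟧)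
    ≡⟨ ∑-distrib-+ {n} (λ d → ⟦ lookup ⁅ k ⁆ d ∧ p d ⟧) _ ⟩
  ∑[ d < n ] ⟦ lookup ⁅ k ⁆ d ∧ p d ⟧ + count∉ (⁅ k ⁆ ∪ S) p
    ≡⟨ cong (_+ count∉ (⁅ k ⁆ ∪ S) p) (∑-⁅⁆ k p) ⟩
  ⟦ p k ⟧ + count∉ (⁅ k ⁆ ∪ S) p ∎
  where
  open ≡-Reasoning
  pointwise : ∀ d → ⟦ not (lookup S d) ∧ p d ⟧
                  ≡ ⟦ lookup ⁅ k ⁆ d ∧ p d ⟧ + ⟦ not (lookup (⁅ k ⁆ ∪ S) d) ∧ p d ⟧
  pointwise d rewrite lookup-∪ ⁅ k ⁆ S d with lookup ⁅ k ⁆ d in d∈⁅k⁆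
  ... | false = refl
  ... | true with refl ← lookup-⁅y⁆⇒≡ {i = d} {k} d∈⁅k⁆ rewrite k∉S = sym (+-identityʳ _)

count∉-witness : ∀ {n} (S : Subset n) (p q : Fin n → Bool) → count∉ S p ≡ count∉ S q →
                 ∀ {d} → lookup S d ≡ false → p d ≡ true → q d ≡ false →
                 ∃[ e ] lookup S e ≡ false × p e ≡ false × q e ≡ true
count∉-witness S p q same {d} d∉S pd qd
  with any? (λ e → (lookup S e Bool.≟ false) ×-dec (p e Bool.≟ false) ×-dec (q e Bool.≟ true))
... | yes witness = witness
... | no none = ⊥-elim (<-irrefl (sym same) (∑-mono-< q≤p d at-d))
  where
  q≤p : ∀ e → ⟦ not (lookup S e) ∧ q e ⟧ ≤ ⟦ not (lookup S e) ∧ p e ⟧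
  q≤p e with lookup S e in se | p e in pe | q e in qe
  ... | true  | _     | _     = z≤n
  ... | false | true  | y     = ⟦⟧≤1 y
  ... | false | false | false = z≤n
  ... | false | false | true  = ⊥-elim (none (e , se , pe , qe))
  at-d : ⟦ not (lookup S d) ∧ q d ⟧ < ⟦ not (lookup S d) ∧ p d ⟧
  at-d rewrite d∉S | pd | qd = s≤s z≤n

-- Sums over all subsets of Fin n

∑ₛ : ∀ {n} → (Subset n → ℕ) → ℕ
∑ₛ {zero}  f = f []
∑ₛ {suc n} f = ∑ₛ (f ∘ (outside ∷_)) + ∑ₛ (f ∘ (inside ∷_))

∑ₛ-cong : ∀ {n} {f g : Subset n → ℕ} → (∀ v → f v ≡ g v) → ∑ₛ f ≡ ∑ₛ g
∑ₛ-cong {zero}  f≗g = f≗g []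
∑ₛ-cong {suc n} f≗g = cong₂ _+_ (∑ₛ-cong (f≗g ∘ (outside ∷_))) (∑ₛ-cong (f≗g ∘ (inside ∷_)))

∑ₛ-zero : ∀ {n} {f : Subset n → ℕ} → (∀ v → f v ≡ 0) → ∑ₛ f ≡ 0
∑ₛ-zero {zero}  f≗0 = f≗0 []
∑ₛ-zero {suc n} f≗0 = cong₂ _+_ (∑ₛ-zero (f≗0 ∘ (outside ∷_))) (∑ₛ-zero (f≗0 ∘ (inside ∷_)))

∑ₛ-distrib-+ : ∀ {n} (f g : Subset n → ℕ) → ∑ₛ (λ v → f v + g v) ≡ ∑ₛ f + ∑ₛ g
∑ₛ-distrib-+ {zero}  f g = refl
∑ₛ-distrib-+ {suc n} f g =
  trans (cong₂ _+_ (∑ₛ-distrib-+ (f ∘ (outside ∷_)) (g ∘ (outside ∷_)))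
                   (∑ₛ-distrib-+ (f ∘ (inside ∷_)) (g ∘ (inside ∷_))))
        (interchange (∑ₛ (f ∘ (outside ∷_))) (∑ₛ (g ∘ (outside ∷_)))
                     (∑ₛ (f ∘ (inside ∷_))) (∑ₛ (g ∘ (inside ∷_))))

∑ₛ-* : ∀ {n} k (f : Subset n → ℕ) → ∑ₛ (λ v → k * f v) ≡ k * ∑ₛ f
∑ₛ-* {zero}  k f = refl
∑ₛ-* {suc n} k f = trans (cong₂ _+_ (∑ₛ-* k (f ∘ (outside ∷_))) (∑ₛ-* k (f ∘ (inside ∷_))))
                         (sym (*-distribˡ-+ k _ _))

sum-map-allSubsets : ∀ n (f : Subset n → ℕ) → sumᴸ (map f (allSubsets n)) ≡ ∑ₛ f
sum-map-allSubsets zero    f = +-identityʳ (f [])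
sum-map-allSubsets (suc n) f = begin
  sumᴸ (map f (map (outside ∷_) A ++ map (inside ∷_) A))
    ≡⟨ cong sumᴸ (map-++ f (map (outside ∷_) A) _) ⟩
  sumᴸ (map f (map (outside ∷_) A) ++ map f (map (inside ∷_) A))
    ≡⟨ sum-++ (map f (map (outside ∷_) A)) _ ⟩
  sumᴸ (map f (map (outside ∷_) A)) + sumᴸ (map f (map (inside ∷_) A))
    ≡⟨ cong₂ (λ xs ys → sumᴸ xs + sumᴸ ys) (map-∘ A) (map-∘ A) ⟨
  sumᴸ (map (f ∘ (outside ∷_)) A) + sumᴸ (map (f ∘ (inside ∷_)) A)
    ≡⟨ cong₂ _+_ (sum-map-allSubsets n _) (sum-map-allSubsets n _) ⟩
  ∑ₛ f ∎
  where
  open ≡-Reasoning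
  A : L.List (Subset n)
  A = allSubsets n

length-filterᵇ-filterᵇ : ∀ {A : Set} (p q : A → Bool) xs →
  length (filterᵇ q (filterᵇ p xs)) ≡ sumᴸ (map (λ x → ⟦ p x ∧ q x ⟧) xs)
length-filterᵇ-filterᵇ p q L.[] = refl
length-filterᵇ-filterᵇ p q (x L.∷ xs) with p x
... | false = length-filterᵇ-filterᵇ p q xs
... | true with q x
...   | false = length-filterᵇ-filterᵇ p q xs
...   | true  = cong suc (length-filterᵇ-filterᵇ p q xs)

count-J3vertices : ∀ n (q : Subset n → Bool) →
  length (filterᵇ q (J3vertices n)) ≡ ∑ₛ (λ v → ⟦ (∣ v ∣ ≡ᵇ 3) ∧ q v ⟧)
count-J3vertices n q = trans (length-filterᵇ-filterᵇ _ q (allSubsets n)) (sum-map-allSubsets n _)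

infix 7 _⊆ᵇ_
_⊆ᵇ_ : ∀ {n} → Subset n → Subset n → Bool
[]            ⊆ᵇ []      = true
(outside ∷ S) ⊆ᵇ (_ ∷ v) = S ⊆ᵇ v
(inside ∷ S)  ⊆ᵇ (x ∷ v) = x ∧ S ⊆ᵇ v

⊆ᵇ⇒∣∣≤ : ∀ {n} (S v : Subset n) → S ⊆ᵇ v ≡ true → ∣ S ∣ ≤ ∣ v ∣
⊆ᵇ⇒∣∣≤ []            []          _   = z≤n
⊆ᵇ⇒∣∣≤ (outside ∷ S) (outside ∷ v) S⊆v = ⊆ᵇ⇒∣∣≤ S v S⊆v
⊆ᵇ⇒∣∣≤ (outside ∷ S) (inside ∷ v)  S⊆v = m≤n⇒m≤1+n (⊆ᵇ⇒∣∣≤ S v S⊆v)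
⊆ᵇ⇒∣∣≤ (inside ∷ S)  (inside ∷ v)  S⊆v = s≤s (⊆ᵇ⇒∣∣≤ S v S⊆v)

∅-⊆ᵇ : ∀ {n} (v : Subset n) → ∅ ⊆ᵇ v ≡ true
∅-⊆ᵇ []      = refl
∅-⊆ᵇ (_ ∷ v) = ∅-⊆ᵇ v

⁅⁆-⊆ᵇ : ∀ {n} (i : Fin n) (v : Subset n) → ⁅ i ⁆ ⊆ᵇ v ≡ lookup v i
⁅⁆-⊆ᵇ zero    (x ∷ v) rewrite ∅-⊆ᵇ v = ∧-identityʳ x
⁅⁆-⊆ᵇ (suc i) (_ ∷ v) = ⁅⁆-⊆ᵇ i v

⁅⁆∪-⊆ᵇ : ∀ {n} (i : Fin n) (p v : Subset n) → (⁅ i ⁆ ∪ p) ⊆ᵇ v ≡ lookup v i ∧ p ⊆ᵇ v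
⁅⁆∪-⊆ᵇ zero    (s ∷ p) (x ∷ v) rewrite ∪-identityˡ p with s | x
... | outside | _     = refl
... | inside  | true  = refl
... | inside  | false = refl
⁅⁆∪-⊆ᵇ (suc i) (outside ∷ p) (x ∷ v) = ⁅⁆∪-⊆ᵇ i p v
⁅⁆∪-⊆ᵇ (suc i) (inside ∷ p)  (true ∷ v)  = ⁅⁆∪-⊆ᵇ i p v
⁅⁆∪-⊆ᵇ (suc i) (inside ∷ p)  (false ∷ v) = sym (∧-zeroʳ (lookup v i))

pair-⊆ᵇ : ∀ {n} (i j : Fin n) v → (⁅ i ⁆ ∪ ⁅ j ⁆) ⊆ᵇ v ≡ lookup v i ∧ lookup v j
pair-⊆ᵇ i j v = trans (⁅⁆∪-⊆ᵇ i ⁅ j ⁆ v) (cong (lookup v i ∧_) (⁅⁆-⊆ᵇ j v))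

triple-⊆ᵇ : ∀ {n} (a b c : Fin n) v → triple a b c ⊆ᵇ v ≡ lookup v a ∧ (lookup v b ∧ lookup v c)
triple-⊆ᵇ a b c v = trans (⁅⁆∪-⊆ᵇ a (⁅ b ⁆ ∪ ⁅ c ⁆) v) (cong (lookup v a ∧_) (pair-⊆ᵇ b c v))

∑ₛ-⊇-same-size : ∀ {n} (S : Subset n) (p : Subset n → Bool) →
  ∑ₛ (λ v → ⟦ (∣ v ∣ ≡ᵇ ∣ S ∣) ∧ S ⊆ᵇ v ∧ p v ⟧) ≡ ⟦ p S ⟧
∑ₛ-⊇-same-size []            p = refl
∑ₛ-⊇-same-size (outside ∷ S) p =
  trans (cong₂ _+_ (∑ₛ-⊇-same-size S (p ∘ (outside ∷_))) (∑ₛ-zero too-large)) (+-identityʳ _)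
  where
  too-large : ∀ v → ⟦ (suc ∣ v ∣ ≡ᵇ ∣ S ∣) ∧ S ⊆ᵇ v ∧ p (inside ∷ v) ⟧ ≡ 0
  too-large v with S ⊆ᵇ v in S⊆v | suc ∣ v ∣ ≡ᵇ ∣ S ∣ in size
  ... | false | b     = cong ⟦_⟧ (∧-zeroʳ b)
  ... | true  | false = refl
  ... | true  | true  = ⊥-elim (<⇒≱ (≤-reflexive (≡ᵇ⇒≡ _ _ (subst T (sym size) _))) (⊆ᵇ⇒∣∣≤ S v S⊆v))
∑ₛ-⊇-same-size {suc n} (inside ∷ S) p =
  cong₂ _+_ (∑ₛ-zero {n} λ v → cong ⟦_⟧ (∧-zeroʳ (∣ v ∣ ≡ᵇ suc ∣ S ∣)))
            (∑ₛ-⊇-same-size S (p ∘ (inside ∷_)))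

∑ₛ-⊇-one-larger : ∀ {n} (S : Subset n) (p : Subset n → Bool) →
  ∑ₛ (λ v → ⟦ (∣ v ∣ ≡ᵇ suc ∣ S ∣) ∧ S ⊆ᵇ v ∧ p v ⟧) ≡ count∉ S (λ d → p (⁅ d ⁆ ∪ S))
∑ₛ-⊇-one-larger []            p = refl
∑ₛ-⊇-one-larger (outside ∷ S) p rewrite ∪-identityˡ S =
  trans (cong₂ _+_ (∑ₛ-⊇-one-larger S (p ∘ (outside ∷_))) (∑ₛ-⊇-same-size S (p ∘ (inside ∷_))))
        (+-comm _ ⟦ p (inside ∷ S) ⟧)
∑ₛ-⊇-one-larger {suc n} (inside ∷ S) p =
  cong₂ _+_ (∑ₛ-zero {n} λ v → cong ⟦_⟧ (∧-zeroʳ (∣ v ∣ ≡ᵇ suc (suc ∣ S ∣))))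
            (∑ₛ-⊇-one-larger S (p ∘ (inside ∷_)))

-- Pair counts in J(n,3)

module _ {n : ℕ} (X : Partition n) where

  open ≡-Reasoning

  pairStar≡count∉ : ∀ {i j} → i ≢ j → pairStar X i j ≡ count∉ (⁅ i ⁆ ∪ ⁅ j ⁆) (λ d → X (triple i j d))
  pairStar≡count∉ {i} {j} i≢j = begin
    pairStar X i j
      ≡⟨ count-J3vertices n _ ⟩
    ∑ₛ (λ v → ⟦ (∣ v ∣ ≡ᵇ 3) ∧ (lookup v i ∧ (lookup v j ∧ X v)) ⟧)
      ≡⟨ ∑ₛ-cong contains-pair ⟩
    ∑ₛ (λ v → ⟦ (∣ v ∣ ≡ᵇ suc ∣ S ∣) ∧ S ⊆ᵇ v ∧ X v ⟧)
      ≡⟨ ∑ₛ-⊇-one-larger S X ⟩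
    count∉ S (λ d → X (triple d i j))
      ≡⟨ count∉-cong S (λ d → cong X (triple-rotate d i j)) ⟩
    count∉ S (λ d → X (triple i j d)) ∎
    where
    S : Subset n
    S = ⁅ i ⁆ ∪ ⁅ j ⁆
    contains-pair : ∀ v → ⟦ (∣ v ∣ ≡ᵇ 3) ∧ (lookup v i ∧ (lookup v j ∧ X v)) ⟧
                        ≡ ⟦ (∣ v ∣ ≡ᵇ suc ∣ S ∣) ∧ S ⊆ᵇ v ∧ X v ⟧
    contains-pair v rewrite ∣pair∣ i≢j | pair-⊆ᵇ i j v | ∧-assoc (lookup v i) (lookup v j) (X v) = refl

  pairStar+2≤n : ∀ {i j} → i ≢ j → pairStar X i j + 2 ≤ n
  pairStar+2≤n {i} {j} i≢j =
    subst₂ (λ c s → c + s ≤ n) (sym (pairStar≡count∉ i≢j)) (∣pair∣ i≢j)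
           (count∉+∣S∣≤n (⁅ i ⁆ ∪ ⁅ j ⁆) (λ d → X (triple i j d)))

  pairStar+2≡n⇒∈X₁ : ∀ {i j} → i ≢ j → pairStar X i j + 2 ≡ n →
                     ∀ {d} → d ≢ i → d ≢ j → X (triple i j d) ≡ true
  pairStar+2≡n⇒∈X₁ {i} {j} i≢j full d≢i d≢j =
    count∉-saturated (⁅ i ⁆ ∪ ⁅ j ⁆) _
      (trans (cong₂ _+_ (sym (pairStar≡count∉ i≢j)) (∣pair∣ i≢j)) full) (∉-pair d≢i d≢j)

  pairStar-split : ∀ {i j k} → i ≢ j → k ≢ i → k ≢ j →
    pairStar X i j ≡ ⟦ X (triple i j k) ⟧ + count∉ (triple i j k) (λ d → X (triple i j d))
  pairStar-split {i} {j} {k} i≢j k≢i k≢j = begin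
    pairStar X i j
      ≡⟨ pairStar≡count∉ i≢j ⟩
    count∉ (⁅ i ⁆ ∪ ⁅ j ⁆) (λ d → X (triple i j d))
      ≡⟨ count∉-split (⁅ i ⁆ ∪ ⁅ j ⁆) _ (∉-pair k≢i k≢j) ⟩
    ⟦ X (triple i j k) ⟧ + count∉ (triple k i j) (λ d → X (triple i j d))
      ≡⟨ cong (λ T → ⟦ X (triple i j k) ⟧ + count∉ T _) (triple-rotate k i j) ⟩
    ⟦ X (triple i j k) ⟧ + count∉ (triple i j k) (λ d → X (triple i j d)) ∎

  -- A 3-set v adjacent to u = {a,b,c} contains exactly one of the pairs ab, ac, bc,
  -- whereas v = u contains all three.
  neighbour-count : ∀ t x y z w →
    ⟦ t ∧ (((⟦ x ⟧ + (⟦ y ⟧ + ⟦ z ⟧)) ≡ᵇ 2) ∧ w) ⟧ + 3 * ⟦ t ∧ (x ∧ (y ∧ z)) ∧ w ⟧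
    ≡ ⟦ t ∧ (x ∧ (y ∧ w)) ⟧ + ⟦ t ∧ (x ∧ (z ∧ w)) ⟧ + ⟦ t ∧ (y ∧ (z ∧ w)) ⟧
  neighbour-count false _     _     _     _     = refl
  neighbour-count true  true  true  true  true  = refl
  neighbour-count true  true  true  true  false = refl
  neighbour-count true  true  true  false true  = refl
  neighbour-count true  true  true  false false = refl
  neighbour-count true  true  false true  true  = refl
  neighbour-count true  true  false true  false = refl
  neighbour-count true  true  false false true  = refl
  neighbour-count true  true  false false false = refl
  neighbour-count true  false true  true  true  = refl
  neighbour-count true  false true  true  false = refl
  neighbour-count true  false true  false true  = refl
  neighbour-count true  false true  false false = refl
  neighbour-count true  false false true  true  = refl
  neighbour-count true  false false true  false = refl
  neighbour-count true  false false false true  = refl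
  neighbour-count true  false false false false = refl

  deg₁+3[u]≡pairStars : ∀ {a b c} → a ≢ b → a ≢ c → b ≢ c →
    deg₁ X (triple a b c) + 3 * ⟦ X (triple a b c) ⟧
    ≡ pairStar X a b + pairStar X a c + pairStar X b c
  deg₁+3[u]≡pairStars {a} {b} {c} a≢b a≢c b≢c = begin
    deg₁ X u + 3 * ⟦ X u ⟧
      ≡⟨ cong₂ _+_ (sym (count-J3vertices n _)) (cong (3 *_) (∑ₛ-⊇-same-size u X)) ⟨
    ∑ₛ Adj + 3 * ∑ₛ Eq
      ≡⟨ cong (∑ₛ Adj +_) (∑ₛ-* 3 Eq) ⟨
    ∑ₛ Adj + ∑ₛ (λ v → 3 * Eq v)
      ≡⟨ ∑ₛ-distrib-+ Adj _ ⟨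
    ∑ₛ (λ v → Adj v + 3 * Eq v)
      ≡⟨ ∑ₛ-cong pointwise ⟩
    ∑ₛ (λ v → Has a b v + Has a c v + Has b c v)
      ≡⟨ ∑ₛ-distrib-+ (λ v → Has a b v + Has a c v) _ ⟩
    ∑ₛ (λ v → Has a b v + Has a c v) + ∑ₛ (Has b c)
      ≡⟨ cong (_+ ∑ₛ (Has b c)) (∑ₛ-distrib-+ (Has a b) _) ⟩
    ∑ₛ (Has a b) + ∑ₛ (Has a c) + ∑ₛ (Has b c)
      ≡⟨ cong₂ _+_ (cong₂ _+_ (count-J3vertices n _) (count-J3vertices n _)) (count-J3vertices n _) ⟨
    pairStar X a b + pairStar X a c + pairStar X b c ∎
    where
    u : Subset n
    u = triple a b c
    Adj Eq : Subset n → ℕ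
    Adj v = ⟦ (∣ v ∣ ≡ᵇ 3) ∧ (adj u v ∧ X v) ⟧
    Eq v = ⟦ (∣ v ∣ ≡ᵇ ∣ u ∣) ∧ u ⊆ᵇ v ∧ X v ⟧
    Has : Fin n → Fin n → Subset n → ℕ
    Has i j v = ⟦ (∣ v ∣ ≡ᵇ 3) ∧ (lookup v i ∧ (lookup v j ∧ X v)) ⟧
    pointwise : ∀ v → Adj v + 3 * Eq v ≡ Has a b v + Has a c v + Has b c v
    pointwise v rewrite ∣triple∣ a≢b a≢c b≢c | ∣triple∩∣ a≢b a≢c b≢c v | triple-⊆ᵇ a b c v =
      neighbour-count (∣ v ∣ ≡ᵇ 3) (lookup v a) (lookup v b) (lookup v c) (X v)

-- Arithmetic

-- In the applications K, L, A, B, C are the pair counts of ab, ac (= bc), ad, bd, cd.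

x+x≡y+y⇒x≡y : ∀ {x y} → x + x ≡ y + y → x ≡ y
x+x≡y+y⇒x≡y {x} {y} eq = *-cancelˡ-≡ x y 2 (trans (double x) (trans eq (sym (double y))))
  where
  double : ∀ z → 2 * z ≡ z + z
  double = solve-∀

module _ {n p K L : ℕ} (abc : K + L + L ≡ p + 3) (gap : 2 * K + 4 ≡ 2 * L + n) where

  K+2≡n : 2 * n ≤ p + 7 → K + 2 ≤ n → K + 2 ≡ n
  K+2≡n p-large K+2≤n = ≤-antisym K+2≤n (m<1+n⇒m≤n (*-cancelˡ-< 3 n (suc (K + 2)) 3n<))
    where
    open ≤-Reasoning
    3n< : 3 * n < 3 * suc (K + 2)
    3n< = begin-strict
      3 * n                  ≡⟨ solve (toList (n ∷ [])) ⟩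
      2 * n + n              ≤⟨ +-monoˡ-≤ n p-large ⟩
      p + 7 + n              ≡⟨ solve (toList (p ∷ n ∷ [])) ⟩
      p + 3 + 4 + n          ≡⟨ cong (λ t → t + 4 + n) abc ⟨
      K + L + L + 4 + n      ≡⟨ solve (toList (K ∷ L ∷ n ∷ [])) ⟩
      K + 4 + (2 * L + n)    ≡⟨ cong (K + 4 +_) gap ⟨
      K + 4 + (2 * K + 4)    <⟨ n<1+n _ ⟩
      suc (K + 4 + (2 * K + 4)) ≡⟨ solve (toList (K ∷ [])) ⟩
      3 * suc (K + 2)        ∎

  L+L≡n : K + 2 ≡ n → L + L ≡ n
  L+L≡n K+2≡n = +-cancelʳ-≡ n (L + L) n (begin
    L + L + n          ≡⟨ solve (toList (L ∷ n ∷ [])) ⟩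
    2 * L + n          ≡⟨ gap ⟨
    2 * K + 4          ≡⟨ solve (toList (K ∷ [])) ⟩
    (K + 2) + (K + 2)  ≡⟨ cong₂ _+_ K+2≡n K+2≡n ⟩
    n + n              ∎)
    where open ≡-Reasoning

  p+5≡n+n : K + 2 ≡ n → p + 5 ≡ n + n
  p+5≡n+n K+2≡n = begin
    p + 5              ≡⟨ solve (toList (p ∷ [])) ⟩
    p + 3 + 2          ≡⟨ cong (_+ 2) abc ⟨
    K + L + L + 2      ≡⟨ solve (toList (K ∷ L ∷ [])) ⟩
    (K + 2) + (L + L)  ≡⟨ cong₂ _+_ K+2≡n (L+L≡n K+2≡n) ⟩
    n + n              ∎
    where open ≡-Reasoning

module _ {n p : ℕ} (p+5≡n+n : p + 5 ≡ n + n) where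

  open ≡-Reasoning

  q≡n+2 : ∀ {q} → p + 7 ≡ n + q → q ≡ n + 2
  q≡n+2 {q} λ₂ = +-cancelˡ-≡ n q (n + 2) (begin
    n + q          ≡⟨ λ₂ ⟨
    p + 7          ≡⟨ solve (toList (p ∷ [])) ⟩
    p + 5 + 2      ≡⟨ cong (_+ 2) p+5≡n+n ⟩
    n + n + 2      ≡⟨ solve (toList (n ∷ [])) ⟩
    n + (n + 2)    ∎)

  mixed-profile : ∀ {K L A B C q} → K + 2 ≡ n → q ≡ n + 2 →
    K + A + B ≡ p + 3 → L + A + C ≡ p + 3 → L + B + C ≡ q → A + 2 ≡ n × B ≡ 2
  mixed-profile {K} {L} {A} {B} {C} {q} K+2≡n q≡ abd acd bcd = A+2≡n , B≡2
    where
    A+B≡n : A + B ≡ n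
    A+B≡n = +-cancelˡ-≡ (K + 2) (A + B) n (begin
      (K + 2) + (A + B)  ≡⟨ solve (toList (K ∷ A ∷ B ∷ [])) ⟩
      K + A + B + 2      ≡⟨ cong (_+ 2) abd ⟩
      p + 3 + 2          ≡⟨ solve (toList (p ∷ [])) ⟩
      p + 5              ≡⟨ p+5≡n+n ⟩
      n + n              ≡⟨ cong (_+ n) K+2≡n ⟨
      (K + 2) + n        ∎)
    A+4≡B+n : A + 4 ≡ B + n
    A+4≡B+n = +-cancelˡ-≡ (L + C) (A + 4) (B + n) (begin
      (L + C) + (A + 4)  ≡⟨ solve (toList (L ∷ C ∷ A ∷ [])) ⟩
      L + A + C + 4      ≡⟨ cong (_+ 4) acd ⟩
      p + 3 + 4          ≡⟨ solve (toList (p ∷ [])) ⟩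
      p + 5 + 2          ≡⟨ cong (_+ 2) p+5≡n+n ⟩
      n + n + 2          ≡⟨ solve (toList (n ∷ [])) ⟩
      (n + 2) + n        ≡⟨ cong (_+ n) (trans bcd q≡) ⟨
      L + B + C + n      ≡⟨ solve (toList (L ∷ B ∷ C ∷ n ∷ [])) ⟩
      (L + C) + (B + n)  ∎)
    A+2≡n : A + 2 ≡ n
    A+2≡n = x+x≡y+y⇒x≡y (begin
      (A + 2) + (A + 2)  ≡⟨ solve (toList (A ∷ [])) ⟩
      (A + 4) + A        ≡⟨ cong (_+ A) A+4≡B+n ⟩
      (B + n) + A        ≡⟨ solve (toList (B ∷ n ∷ A ∷ [])) ⟩
      (A + B) + n        ≡⟨ cong (_+ n) A+B≡n ⟩
      n + n              ∎)
    B≡2 : B ≡ 2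
    B≡2 = +-cancelˡ-≡ A B 2 (trans A+B≡n (sym A+2≡n))

  third-pair-count≡2 : ∀ {A A′ D} → A + 2 ≡ n → A′ + 2 ≡ n → A + A′ + D ≡ p + 3 → D ≡ 2
  third-pair-count≡2 {A} {A′} {D} A+2≡n A′+2≡n sum≡ = +-cancelˡ-≡ (n + n) D 2 (begin
    (n + n) + D              ≡⟨ cong (λ t → t + D) (cong₂ _+_ A+2≡n A′+2≡n) ⟨
    (A + 2) + (A′ + 2) + D   ≡⟨ solve (toList (A ∷ A′ ∷ D ∷ [])) ⟩
    A + A′ + D + 4           ≡⟨ cong (_+ 4) sum≡ ⟩
    p + 3 + 4                ≡⟨ solve (toList (p ∷ [])) ⟩
    p + 5 + 2                ≡⟨ cong (_+ 2) p+5≡n+n ⟩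
    (n + n) + 2              ∎)

  six-is-no-pairStar-sum : ∀ {q} → 6 ≤ n → q ≡ n + 2 → ¬ (6 ≡ p + 3 ⊎ 6 ≡ q)
  six-is-no-pairStar-sum 6≤n q≡ (inj₁ 6≡p+3) = from-no (12 ≤? 8) (subst (12 ≤_) n+n≡8 (+-mono-≤ 6≤n 6≤n))
    where
    n+n≡8 : n + n ≡ 8
    n+n≡8 = begin
      n + n      ≡⟨ p+5≡n+n ⟨
      p + 5      ≡⟨ solve (toList (p ∷ [])) ⟩
      p + 3 + 2  ≡⟨ cong (_+ 2) 6≡p+3 ⟨
      8          ∎
  six-is-no-pairStar-sum 6≤n q≡ (inj₂ 6≡q) =
    from-no (6 ≤? 4) (subst (6 ≤_) (+-cancelʳ-≡ 2 n 4 (sym (trans 6≡q q≡))) 6≤n)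

-- Equitable partitions

GoodC-diag : ∀ y → GoodC (true , y , y)
GoodC-diag true  = c111
GoodC-diag false = c100

module EquitablePartition {n : ℕ} (X : Partition n) {p₁₁ p₁₂ p₂₁ p₂₂ : ℕ}
                          (equitable : IsEquitable X p₁₁ p₁₂ p₂₁ p₂₂) where

  P : Fin n → Fin n → ℕ
  P = pairStar X

  pairStars-X₁ : ∀ {x y z} → x ≢ y → x ≢ z → y ≢ z → X (triple x y z) ≡ true →
                 P x y + P x z + P y z ≡ p₁₁ + 3
  pairStars-X₁ {x} {y} {z} x≢y x≢z y≢z u∈X₁ = begin
    P x y + P x z + P y z             ≡⟨ deg₁+3[u]≡pairStars X x≢y x≢z y≢z ⟨
    deg₁ X u + 3 * ⟦ X u ⟧
      ≡⟨ cong₂ _+_ (proj₁ (proj₁ (equitable u ∣u∣≡3) u∈X₁)) (cong (λ b → 3 * ⟦ b ⟧) u∈X₁) ⟩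
    p₁₁ + 3                           ∎
    where
    open ≡-Reasoning
    u : Subset n
    u = triple x y z
    ∣u∣≡3 : ∣ u ∣ ≡ 3
    ∣u∣≡3 = ∣triple∣ x≢y x≢z y≢z

  pairStars-X₂ : ∀ {x y z} → x ≢ y → x ≢ z → y ≢ z → X (triple x y z) ≡ false →
                 P x y + P x z + P y z ≡ p₂₁
  pairStars-X₂ {x} {y} {z} x≢y x≢z y≢z u∈X₂ = begin
    P x y + P x z + P y z             ≡⟨ deg₁+3[u]≡pairStars X x≢y x≢z y≢z ⟨
    deg₁ X u + 3 * ⟦ X u ⟧
      ≡⟨ cong₂ _+_ (proj₁ (proj₂ (equitable u ∣u∣≡3) u∈X₂)) (cong (λ b → 3 * ⟦ b ⟧) u∈X₂) ⟩
    p₂₁ + 0                           ≡⟨ +-identityʳ p₂₁ ⟩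
    p₂₁                               ∎
    where
    open ≡-Reasoning
    u : Subset n
    u = triple x y z
    ∣u∣≡3 : ∣ u ∣ ≡ 3
    ∣u∣≡3 = ∣triple∣ x≢y x≢z y≢z

  pairStars : ∀ {x y z} → x ≢ y → x ≢ z → y ≢ z →
              P x y + P x z + P y z ≡ p₁₁ + 3 ⊎ P x y + P x z + P y z ≡ p₂₁
  pairStars {x} {y} {z} x≢y x≢z y≢z with X (triple x y z) in u∈
  ... | true  = inj₁ (pairStars-X₁ x≢y x≢z y≢z u∈)
  ... | false = inj₂ (pairStars-X₂ x≢y x≢z y≢z u∈)

  module Vertex (6≤n : 6 ≤ n) (λ₂ : IsLambda2 n p₁₁ p₂₁) (p₁₁-large : p₁₁ + 7 ≥ 2 * n)
                {a b c : Fin n} (a≢b : a ≢ b) (a≢c : a ≢ c) (b≢c : b ≢ c)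
                (abc∈X₁ : X (triple a b c) ≡ true)
                (gap : 2 * P a b + 4 ≡ 2 * P a c + n) (ac≡bc : P a c ≡ P b c) where

    abc-sum : P a b + P a c + P a c ≡ p₁₁ + 3
    abc-sum = trans (cong (P a b + P a c +_) ac≡bc) (pairStars-X₁ a≢b a≢c b≢c abc∈X₁)

    ab-saturated : P a b + 2 ≡ n
    ab-saturated = K+2≡n abc-sum gap p₁₁-large (pairStar+2≤n X a≢b)

    p₁₁+5≡n+n : p₁₁ + 5 ≡ n + n
    p₁₁+5≡n+n = p+5≡n+n abc-sum gap ab-saturated

    p₂₁≡n+2 : p₂₁ ≡ n + 2
    p₂₁≡n+2 = q≡n+2 p₁₁+5≡n+n λ₂

    abd∈X₁ : ∀ {d} → d ≢ a → d ≢ b → X (triple a b d) ≡ true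
    abd∈X₁ = pairStar+2≡n⇒∈X₁ X a≢b ab-saturated

    good-if-balanced : ∀ {d} → d ≢ a → d ≢ b → X (triple a c d) ≡ X (triple b c d) →
                       GoodC (Cvec X a b c d)
    good-if-balanced {d} d≢a d≢b acd≡bcd =
      subst GoodC (sym (cong₂ _,_ (abd∈X₁ d≢a d≢b) (cong (_, X (triple b c d)) acd≡bcd))) (GoodC-diag _)

    Mixed : Bool → Bool → Fin n → Set
    Mixed x y d = lookup (triple a b c) d ≡ false × X (triple a c d) ≡ x × X (triple b c d) ≡ y

    mixed? : ∀ x y d → Dec (Mixed x y d)
    mixed? x y d =
      (lookup (triple a b c) d Bool.≟ false) ×-dec (X (triple a c d) Bool.≟ x)
                                             ×-dec (X (triple b c d) Bool.≟ y)

    ac-only-profile : ∀ {d} → Mixed true false d → P a d + 2 ≡ n × P b d ≡ 2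
    ac-only-profile {d} (d∉abc , acd∈X₁ , bcd∈X₂) with ∉-triple⁻ {a = a} {b} {c} d∉abc
    ... | d≢a , d≢b , d≢c =
      mixed-profile p₁₁+5≡n+n {P a b} {P a c} {P a d} {P b d} {P c d} ab-saturated p₂₁≡n+2
      (pairStars-X₁ a≢b (≢-sym d≢a) (≢-sym d≢b) (abd∈X₁ d≢a d≢b))
      (pairStars-X₁ a≢c (≢-sym d≢a) (≢-sym d≢c) acd∈X₁)
      (trans (cong (λ t → t + P b d + P c d) ac≡bc) (pairStars-X₂ b≢c (≢-sym d≢b) (≢-sym d≢c) bcd∈X₂))

    bc-only-profile : ∀ {d} → Mixed false true d → P b d + 2 ≡ n × P a d ≡ 2
    bc-only-profile {d} (d∉abc , acd∈X₂ , bcd∈X₁) with ∉-triple⁻ {a = a} {b} {c} d∉abc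
    ... | d≢a , d≢b , d≢c =
      mixed-profile p₁₁+5≡n+n {P a b} {P a c} {P b d} {P a d} {P c d} ab-saturated p₂₁≡n+2
      (trans (xy∙z≈xz∙y (P a b) (P b d) (P a d))
             (pairStars-X₁ a≢b (≢-sym d≢a) (≢-sym d≢b) (abd∈X₁ d≢a d≢b)))
      (trans (cong (λ t → t + P b d + P c d) ac≡bc) (pairStars-X₁ b≢c (≢-sym d≢b) (≢-sym d≢c) bcd∈X₁))
      (pairStars-X₂ a≢c (≢-sym d≢a) (≢-sym d≢c) acd∈X₂)

    -- Two points d, e with this profile put {x,d,e} in X₁ and force P d e = 2, so that
    -- {y,d,e} would have pair-count sum 6, which is neither p₁₁ + 3 = 2n − 2 nor p₂₁ = n + 2.
    no-two-profiles : ∀ {x y d e} → d ≢ x → d ≢ y → e ≢ x → e ≢ y → d ≢ e →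
      P x d + 2 ≡ n → P x e + 2 ≡ n → P y d ≡ 2 → P y e ≡ 2 → ⊥
    no-two-profiles {x} {y} {d} {e} d≢x d≢y e≢x e≢y d≢e xd xe yd ye =
      six-is-no-pairStar-sum p₁₁+5≡n+n 6≤n p₂₁≡n+2
        (Sum.map (trans (sym six)) (trans (sym six)) (pairStars (≢-sym d≢y) (≢-sym e≢y) d≢e))
      where
      de≡2 : P d e ≡ 2
      de≡2 = third-pair-count≡2 p₁₁+5≡n+n {P x d} {P x e} xd xe
        (pairStars-X₁ (≢-sym d≢x) (≢-sym e≢x) d≢e (pairStar+2≡n⇒∈X₁ X (≢-sym d≢x) xd e≢x (≢-sym d≢e)))
      six : P y d + P y e + P d e ≡ 6
      six = cong₂ _+_ (cong₂ _+_ yd ye) de≡2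

    balanced : count∉ (triple a b c) (λ d → X (triple a c d))
             ≡ count∉ (triple a b c) (λ d → X (triple b c d))
    balanced = +-cancelˡ-≡ ⟦ X u ⟧ _ _ (begin
      ⟦ X u ⟧ + count∉ u β
        ≡⟨ cong (λ S → ⟦ X S ⟧ + count∉ S β) (triple-swap a b c) ⟨
      ⟦ X (triple a c b) ⟧ + count∉ (triple a c b) β
        ≡⟨ pairStar-split X a≢c (≢-sym a≢b) b≢c ⟨
      P a c
        ≡⟨ ac≡bc ⟩
      P b c
        ≡⟨ pairStar-split X b≢c a≢b a≢c ⟩
      ⟦ X (triple b c a) ⟧ + count∉ (triple b c a) γ
        ≡⟨ cong (λ S → ⟦ X S ⟧ + count∉ S γ) (triple-rotate a b c) ⟨
      ⟦ X u ⟧ + count∉ u γ ∎)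
      where
      open ≡-Reasoning
      u : Subset n
      u = triple a b c
      β γ : Fin n → Bool
      β d = X (triple a c d)
      γ d = X (triple b c d)

    ac-only⇒bc-only : ∀ {d} → Mixed true false d → ∃[ e ] Mixed false true e
    ac-only⇒bc-only (d∉abc , acd , bcd) = count∉-witness (triple a b c) _ _ balanced d∉abc acd bcd

    bc-only⇒ac-only : ∀ {d} → Mixed false true d → ∃[ e ] Mixed true false e
    bc-only⇒ac-only (d∉abc , acd , bcd)
      with e , e∉abc , bce , ace ← count∉-witness (triple a b c) _ _ (sym balanced) d∉abc bcd acd
      = e , e∉abc , ace , bce

    good-unless-mixed : ∀ {f} → f ≢ a → f ≢ b → f ≢ c →
      ¬ Mixed true false f → ¬ Mixed false true f → GoodC (Cvec X a b c f)
    good-unless-mixed {f} f≢a f≢b f≢c ¬ac ¬bc = by-cases _ _ refl refl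
      where
      by-cases : ∀ x y → X (triple a c f) ≡ x → X (triple b c f) ≡ y → GoodC (Cvec X a b c f)
      by-cases true  true  acf bcf = good-if-balanced f≢a f≢b (trans acf (sym bcf))
      by-cases false false acf bcf = good-if-balanced f≢a f≢b (trans acf (sym bcf))
      by-cases true  false acf bcf = ⊥-elim (¬ac (∉-triple f≢a f≢b f≢c , acf , bcf))
      by-cases false true  acf bcf = ⊥-elim (¬bc (∉-triple f≢a f≢b f≢c , acf , bcf))

    fresh : ∀ {x y d} → Mixed x y d → d ≢ a × d ≢ b × d ≢ c
    fresh (d∉abc , _) = ∉-triple⁻ {a = a} {b} {c} d∉abc

    mixed-distinct : ∀ {d e} → Mixed true false d → Mixed false true e → d ≢ e
    mixed-distinct (_ , acd , _) (_ , ace , _) refl = true≢false (trans (sym acd) ace)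

    Cvec-ac-only : ∀ {d} → Mixed true false d → Cvec X a b c d ≡ (true , true , false)
    Cvec-ac-only ac-d@(_ , acd , bcd) with d≢a , d≢b , _ ← fresh ac-d =
      cong₂ _,_ (abd∈X₁ d≢a d≢b) (cong₂ _,_ acd bcd)

    Cvec-bc-only : ∀ {e} → Mixed false true e → Cvec X a b c e ≡ (true , false , true)
    Cvec-bc-only bc-e@(_ , ace , bce) with e≢a , e≢b , _ ← fresh bc-e =
      cong₂ _,_ (abd∈X₁ e≢a e≢b) (cong₂ _,_ ace bce)

    ac-only-unique : ∀ {d f} → Mixed true false d → Mixed true false f → f ≢ d → ⊥
    ac-only-unique ac-d ac-f f≢d with fresh ac-d | fresh ac-f
    ... | d≢a , d≢b , _ | f≢a , f≢b , _ =
      no-two-profiles d≢a d≢b f≢a f≢b (≢-sym f≢d)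
        (proj₁ (ac-only-profile ac-d)) (proj₁ (ac-only-profile ac-f))
        (proj₂ (ac-only-profile ac-d)) (proj₂ (ac-only-profile ac-f))

    bc-only-unique : ∀ {e f} → Mixed false true e → Mixed false true f → f ≢ e → ⊥
    bc-only-unique bc-e bc-f f≢e with fresh bc-e | fresh bc-f
    ... | e≢a , e≢b , _ | f≢a , f≢b , _ =
      no-two-profiles e≢b e≢a f≢b f≢a (≢-sym f≢e)
        (proj₁ (bc-only-profile bc-e)) (proj₁ (bc-only-profile bc-f))
        (proj₂ (bc-only-profile bc-e)) (proj₂ (bc-only-profile bc-f))

    good-except : ∀ {d e f} → Mixed true false d → Mixed false true e →
      f ≢ a → f ≢ b → f ≢ c → f ≢ d → f ≢ e → GoodC (Cvec X a b c f)
    good-except ac-d bc-e f≢a f≢b f≢c f≢d f≢e =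
      good-unless-mixed f≢a f≢b f≢c (λ ac-f → ac-only-unique ac-d ac-f f≢d)
                                    (λ bc-f → bc-only-unique bc-e bc-f f≢e)

    all-good : ¬ (∃[ d ] Mixed true false d) → ∀ f → f ≢ a → f ≢ b → f ≢ c → GoodC (Cvec X a b c f)
    all-good no-ac-only f f≢a f≢b f≢c =
      good-unless-mixed f≢a f≢b f≢c (λ ac-f → no-ac-only (f , ac-f))
                                    (λ bc-f → no-ac-only (bc-only⇒ac-only bc-f))

mainTheorem12 : (n : ℕ) → 6 ≤ n →
    (X : Partition n) → IsTwoPartition X →
    (p₁₁ p₁₂ p₂₁ p₂₂ : ℕ) → IsEquitable X p₁₁ p₁₂ p₂₁ p₂₂ →
    IsLambda2 n p₁₁ p₂₁ →
    p₁₁ ≥ p₂₂ → p₁₁ + 7 ≥ 2 * n →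
    (a b c : Fin n) → a ≢ b → a ≢ c → b ≢ c →
    X (triple a b c) ≡ true →
    pairStar X a b ≥ pairStar X a c → pairStar X a c ≥ pairStar X b c →
    2 * pairStar X a b + 4 ≡ 2 * pairStar X a c + n →
    pairStar X a c ≡ pairStar X b c →
    ((d : Fin n) → d ≢ a → d ≢ b → d ≢ c → GoodC (Cvec X a b c d))
    ⊎
    Σ (Fin n) (λ d → Σ (Fin n) (λ e →
      d ≢ a × d ≢ b × d ≢ c × e ≢ a × e ≢ b × e ≢ c × d ≢ e ×
      Cvec X a b c d ≡ (true , true , false) ×
      Cvec X a b c e ≡ (true , false , true) ×
      ((f : Fin n) → f ≢ a → f ≢ b → f ≢ c → f ≢ d → f ≢ e →
        GoodC (Cvec X a b c f))))
mainTheorem12 n 6≤n X _ p₁₁ p₁₂ p₂₁ p₂₂ equitable λ₂ _ p₁₁-large a b c a≢b a≢c b≢c abc∈X₁ _ _ gap ac≡bc =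
  case any? (mixed? true false) of λ where
    (no no-ac-only)  → inj₁ (all-good no-ac-only)
    (yes (d , ac-d)) →
      let e , bc-e          = ac-only⇒bc-only ac-d
          d≢a , d≢b , d≢c   = fresh ac-d
          e≢a , e≢b , e≢c   = fresh bc-e
      in inj₂ (d , e , d≢a , d≢b , d≢c , e≢a , e≢b , e≢c , mixed-distinct ac-d bc-e ,
               Cvec-ac-only ac-d , Cvec-bc-only bc-e ,
               λ f f≢a f≢b f≢c f≢d f≢e → good-except ac-d bc-e f≢a f≢b f≢c f≢d f≢e)
  where
  open EquitablePartition X equitable
  open Vertex 6≤n λ₂ p₁₁-large a≢b a≢c b≢c abc∈X₁ gap ac≡bc
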